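{- Let $\mathbf{D}$ be a dagger kernel category which has equalisers of all parallel pairs, chosen to be dagger monos, and in which every dagger mono is a kernel. Then every zero-epi in $\mathbf{D}$ is an epimorphism.
   Context: A dagger category is a category with a contravariant functor $\dagger$ which is the identity on objects and satisfies $f^{\dagger\dagger}=f$; $f$ is a dagger mono if $f^\dagger\circ f=\mathrm{id}$. A dagger kernel category is a dagger category with a zero object $0$ (giving zero morphisms) in which every morphism $f$ has a kernel (a morphism $k$ with $f\circ k=0$ through which every $g$ with $f\circ g=0$ factors uniquely) that can be chosen to be a dagger mono; $\ker(f)$ denotes it and $\mathrm{coker}(f)=\ker(f^\dagger)^\dagger$. A morphism $e$ is a zero-epi if $f\circ e=0$ implies $f=0$ for every morphism $f$. -}

module Defs where

open import Level using (Level; _⊔_; suc)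
open import Data.Product using (Σ; ∃; ∃-syntax; _×_; _,_)
open import Relation.Binary.PropositionalEquality using (_≡_)

record Category (o h : Level) : Set (suc (o ⊔ h)) where
  infixr 9 _∘_
  field
    Obj : Set o
    Hom : Obj → Obj → Set h
    id  : ∀ {A} → Hom A A
    _∘_ : ∀ {A B C} → Hom B C → Hom A B → Hom A C
    identityˡ : ∀ {A B} {f : Hom A B} → id ∘ f ≡ f
    identityʳ : ∀ {A B} {f : Hom A B} → f ∘ id ≡ f
    assoc : ∀ {A B C D} {f : Hom A B} {g : Hom B C} {h : Hom C D}
          → (h ∘ g) ∘ f ≡ h ∘ (g ∘ f)

∃! : ∀ {a b} {A : Set a} → (A → Set b) → Set (a ⊔ b)
∃! {A = A} P = Σ A λ x → P x × (∀ y → P y → x ≡ y)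

module _ {o h} (C : Category o h) where
  open Category C

  IsInitial : Obj → Set (o ⊔ h)
  IsInitial Z = ∀ B → Σ (Hom Z B) λ f → ∀ g → f ≡ g

  IsTerminal : Obj → Set (o ⊔ h)
  IsTerminal Z = ∀ A → Σ (Hom A Z) λ f → ∀ g → f ≡ g

  IsZeroObj : Obj → Set (o ⊔ h)
  IsZeroObj Z = IsInitial Z × IsTerminal Z

  IsEpi : ∀ {A B} → Hom A B → Set (o ⊔ h)
  IsEpi {B = B} e = ∀ {X} (f g : Hom B X) → f ∘ e ≡ g ∘ e → f ≡ g

record DaggerCategory (o h : Level) : Set (suc (o ⊔ h)) where
  field
    cat : Category o h
  open Category cat
  field
    _† : ∀ {A B} → Hom A B → Hom B A
    †-id   : ∀ {A} → (id {A}) † ≡ id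
    †-∘    : ∀ {A B C} {f : Hom A B} {g : Hom B C} → (g ∘ f) † ≡ f † ∘ g †
    †-invol : ∀ {A B} {f : Hom A B} → (f †) † ≡ f

module DaggerKernelNotions {o h} (D : DaggerCategory o h) where
  open DaggerCategory D public
  open Category cat public

  IsDaggerMono : ∀ {A B} → Hom A B → Set h
  IsDaggerMono f = f † ∘ f ≡ id

  module WithZero (Z : Obj) (isZ : IsZeroObj cat Z) where
    open import Data.Product using (proj₁)

    zeroHom : ∀ A B → Hom A B
    zeroHom A B = proj₁ (Data.Product.proj₁ isZ B) ∘ proj₁ (Data.Product.proj₂ isZ A)

    IsKernel : ∀ {K A B} → Hom K A → Hom A B → Set (o ⊔ h)
    IsKernel {K} {A} {B} k f =
      (f ∘ k ≡ zeroHom K B) ×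
      (∀ {X} (g : Hom X A) → f ∘ g ≡ zeroHom X B → ∃! (λ (u : Hom X K) → k ∘ u ≡ g))

    IsEqualiser : ∀ {E A B} → Hom E A → Hom A B → Hom A B → Set (o ⊔ h)
    IsEqualiser {E} {A} {B} e f g =
      (f ∘ e ≡ g ∘ e) ×
      (∀ {X} (m : Hom X A) → f ∘ m ≡ g ∘ m → ∃! (λ (u : Hom X E) → e ∘ u ≡ m))

    IsZeroEpi : ∀ {A B} → Hom A B → Set (o ⊔ h)
    IsZeroEpi {A} {B} e = ∀ {C} (f : Hom B C) → f ∘ e ≡ zeroHom A C → f ≡ zeroHom B C

record DaggerKernelCategory (o h : Level) : Set (suc (o ⊔ h)) where
  field
    dagger : DaggerCategory o h
  open DaggerKernelNotions dagger
  field
    zero   : Obj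
    isZero : IsZeroObj cat zero
  open WithZero zero isZero
  field
    kernel : ∀ {A B} (f : Hom A B) →
      Σ Obj λ K → Σ (Hom K A) λ k → IsKernel k f × IsDaggerMono k

module Submission where

-- Let e : A → B be a zero-epi and f, g : B → X with f ∘ e = g ∘ e.  Take the
-- equaliser m : E → B of f and g; it is a dagger mono, hence the kernel of
-- some k : B → C.  Since f ∘ e = g ∘ e, e factors through m, so k ∘ e = 0
-- (k kills everything factoring through its kernel), and as e is a zero-epi,
-- k = 0.  The kernel of a zero morphism admits a section (the identity
-- factors through it), and a morphism with a section is an epimorphism.
-- So m is epi, and f ∘ m = g ∘ m gives f = g.

open import Defs
open import Data.Product using (Σ; _×_; _,_; proj₁; proj₂)
open import Relation.Binary.PropositionalEquality
open ≡-Reasoning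

module SplitEpi {o h} (C : Category o h) where
  open Category C

  section⇒epi : ∀ {E B} {m : Hom E B} (v : Hom B E) → m ∘ v ≡ id → IsEpi C m
  section⇒epi {m = m} v mv≡id f g fm≡gm = begin
    f             ≡⟨ sym identityʳ ⟩
    f ∘ id        ≡⟨ cong (f ∘_) (sym mv≡id) ⟩
    f ∘ (m ∘ v)   ≡⟨ sym assoc ⟩
    (f ∘ m) ∘ v   ≡⟨ cong (_∘ v) fm≡gm ⟩
    (g ∘ m) ∘ v   ≡⟨ assoc ⟩
    g ∘ (m ∘ v)   ≡⟨ cong (g ∘_) mv≡id ⟩
    g ∘ id        ≡⟨ identityʳ ⟩
    g             ∎

module ZeroMorphisms {o h} (D : DaggerCategory o h)
                     (Z : Category.Obj (DaggerCategory.cat D))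
                     (isZ : IsZeroObj (DaggerCategory.cat D) Z) where
  open DaggerKernelNotions D
  open WithZero Z isZ

  -- Zero morphisms absorb precomposition: both sides factor through Z, and
  -- the morphism into the terminal object Z is unique.
  zero-∘ : ∀ {X Y W} (u : Hom X Y) → zeroHom Y W ∘ u ≡ zeroHom X W
  zero-∘ {X} {Y} {W} u = trans assoc
    (cong (proj₁ (proj₁ isZ W) ∘_)
      (sym (proj₂ (proj₂ isZ X) (proj₁ (proj₂ isZ Y) ∘ u))))

  kills-factorisation : ∀ {E A B C} {k : Hom B C} {m : Hom E B} {e : Hom A B}
    (u : Hom A E) → k ∘ m ≡ zeroHom E C → m ∘ u ≡ e → k ∘ e ≡ zeroHom A C
  kills-factorisation {k = k} {m} {e} u km≡0 mu≡e = begin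
    k ∘ e           ≡⟨ cong (k ∘_) (sym mu≡e) ⟩
    k ∘ (m ∘ u)     ≡⟨ sym assoc ⟩
    (k ∘ m) ∘ u     ≡⟨ cong (_∘ u) km≡0 ⟩
    zeroHom _ _ ∘ u ≡⟨ zero-∘ u ⟩
    zeroHom _ _     ∎

  -- A kernel of a zero morphism has a section: the identity is killed by
  -- the zero morphism, so it factors through the kernel.
  kernel-of-zero-section : ∀ {E B C} {m : Hom E B} {k : Hom B C} →
    IsKernel m k → k ≡ zeroHom B C → Σ (Hom B E) λ v → m ∘ v ≡ id
  kernel-of-zero-section (_ , factor) k≡0 =
    let v , mv≡id , _ = factor id (trans identityʳ k≡0) in v , mv≡id

lemma2p10 : ∀ {o h} (D : DaggerKernelCategory o h) →
    let open DaggerKernelCategory D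
        open DaggerKernelNotions dagger
        open WithZero zero isZero
    in
    (∀ {A B} (f g : Hom A B) →
      Σ Obj λ E → Σ (Hom E A) λ e → IsEqualiser e f g × IsDaggerMono e) →
    (∀ {K A} (m : Hom K A) → IsDaggerMono m →
      Σ Obj λ B → Σ (Hom A B) λ f → IsKernel m f) →
    ∀ {A B} (e : Hom A B) → IsZeroEpi e → IsEpi cat e
lemma2p10 D equaliser daggerMono⇒kernel e zeroEpi f g fe≡ge
  with equaliser f g
... | _ , m , (fm≡gm , m-universal) , m-daggerMono
  with daggerMono⇒kernel m m-daggerMono
... | _ , k , m-kernel@(km≡0 , _)
  with m-universal e fe≡ge
... | u , mu≡e , _ =
  let ke≡0 = kills-factorisation u km≡0 mu≡e
      v , mv≡id = kernel-of-zero-section m-kernel (zeroEpi k ke≡0)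
  in section⇒epi v mv≡id f g fm≡gm
  where
  open DaggerKernelCategory D
  open ZeroMorphisms dagger zero isZero
  open SplitEpi (DaggerCategory.cat dagger)
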